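{- Let $n\geq 3$ be an odd integer and $k\geq 3$ an integer. Then the minimum size of a doubly resolving set of vertices of the Cartesian product $C_n\Box P_k$ is $3$, i.e. $\psi(C_n\Box P_k)=3$.
   Context: $C_n$ denotes the cycle on $n$ vertices and $P_k$ the path on $k$ vertices. For graphs $G,H$, the Cartesian product $G\Box H$ has vertex set $V(G)\times V(H)$, with $(g_1,h_1)$ adjacent to $(g_2,h_2)$ iff either $h_1=h_2$ and $g_1g_2\in E(G)$, or $g_1=g_2$ and $h_1h_2\in E(H)$. For a connected graph $G$ and an ordered set $Q=\{q_1,\dots,q_l\}\subseteq V(G)$, $r(x|Q)=(d(x,q_1),\dots,d(x,q_l))$, where $d$ is the shortest-path distance. $Q$ is a doubly resolving set if for any two distinct vertices $x,y$, $r(x|Q)-r(y|Q)\neq\lambda(1,\dots,1)$ for every integer $\lambda$. $\psi(G)$ is the minimum size of a doubly resolving set of $G$. -}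

module Defs where

open import Data.Nat using (ℕ; zero; suc; _+_; _≤_; _%_; NonZero)
open import Data.Integer as ℤ using (ℤ; +_; _-_)
open import Data.Fin using (Fin; toℕ)
open import Data.Product using (_×_; Σ; ∃; _,_)
open import Data.Sum using (_⊎_)
open import Data.List using (List; length)
open import Data.List.Membership.Propositional using (_∈_)
open import Data.List.Relation.Unary.Unique.Propositional using (Unique)
open import Relation.Binary.PropositionalEquality using (_≡_; _≢_)
open import Relation.Nullary using (¬_)

record Graph : Set₁ where
  field
    V   : Set
    Adj : V → V → Set
open Graph public

Cycle : (n : ℕ) → .{{_ : NonZero n}} → Graph
Cycle n = record
  { V   = Fin n
  ; Adj = λ i j → (toℕ j ≡ suc (toℕ i) % n) ⊎ (toℕ i ≡ suc (toℕ j) % n) }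

Path : ℕ → Graph
Path k = record
  { V   = Fin k
  ; Adj = λ i j → (toℕ j ≡ suc (toℕ i)) ⊎ (toℕ i ≡ suc (toℕ j)) }

_□_ : Graph → Graph → Graph
G □ H = record
  { V   = V G × V H
  ; Adj = λ { (g₁ , h₁) (g₂ , h₂) →
              (h₁ ≡ h₂ × Adj G g₁ g₂) ⊎ (g₁ ≡ g₂ × Adj H h₁ h₂) } }

data Walk (G : Graph) : V G → V G → ℕ → Set where
  here : ∀ {x} → Walk G x x 0
  step : ∀ {x y z m} → Adj G x y → Walk G y z m → Walk G x z (suc m)

IsDist : (G : Graph) → V G → V G → ℕ → Set
IsDist G x y d = Walk G x y d × (∀ m → Walk G x y m → d ≤ m)

DistDiffConst : (G : Graph) → List (V G) → V G → V G → Set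
DistDiffConst G Q x y =
  Σ ℤ λ lam → ∀ q → q ∈ Q → ∀ dx dy → IsDist G x q dx → IsDist G y q dy →
    (+ dx) - (+ dy) ≡ lam

DoublyResolving : (G : Graph) → List (V G) → Set
DoublyResolving G Q = ∀ x y → x ≢ y → ¬ DistDiffConst G Q x y

ψ≡ : (G : Graph) → ℕ → Set
ψ≡ G m =
  (Σ (List (V G)) λ Q → Unique Q × DoublyResolving G Q × length Q ≡ m)
  × (∀ (Q : List (V G)) → Unique Q → DoublyResolving G Q → m ≤ length Q)

-- Distances in C_n □ P_k add up coordinatewise.  For n = 2m + 1 the landmarks (0,0), (m,0) and
-- (0,k−1) doubly resolve: the pair (0,0), (0,k−1) recovers the height, since u ↦ |u| − |u − (k−1)|
-- is injective on the path, and the pair (0,0), (m,0) recovers the cycle position, since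
-- u ↦ d(u,0) − d(u,m) is injective on an odd cycle (its two halves give values of opposite
-- parity).  Two landmarks never suffice: if neither lies on the bottom row, (g,0) and (g,1)
-- have distance difference 1 to both; symmetrically if neither lies on the top row; and if one
-- lies on each, either they share a column and two bottom vertices in different columns are not
-- separated, or a step up from the bottom landmark's column is traded against a step along a
-- geodesic towards the top landmark's column.

module Submission where

open import Defs
open import Algebra.Properties.CommutativeSemigroup using (interchange)
open import Data.Empty using (⊥-elim)
open import Data.Fin using (Fin; zero; suc; toℕ; fromℕ; fromℕ<; inject₁)
open import Data.Fin.Properties using (toℕ-fromℕ; toℕ-fromℕ<; toℕ-inject₁; toℕ<n; toℕ-injective; fromℕ≢inject₁)
open import Data.Integer as ℤ using (ℤ; _-_)
open import Data.Integer.Properties using (pos-+; +-injective) renaming (+-comm to ℤ-+-comm)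
import Data.Integer.Tactic.RingSolver as ℤ-Solver
open import Data.List using (List; []; _∷_; length)
open import Data.List.Membership.Propositional using (_∈_)
open import Data.List.Relation.Binary.Subset.Propositional using (_⊆_)
open import Data.List.Relation.Unary.All using ([]; _∷_; lookup)
open import Data.List.Relation.Unary.AllPairs using ([]; _∷_)
open import Data.List.Relation.Unary.Any using (here; there)
open import Data.List.Relation.Unary.Unique.Propositional using (Unique)
open import Data.Nat using (ℕ; zero; suc; _+_; _*_; _∸_; _≤_; _<_; _%_; _/_; _⊓_; ∣_-_∣; z≤n; s≤s; _≟_; NonZero)
open import Data.Nat.DivMod using (m≡m%n+[m/n]*n; m<n⇒m%n≡m; m%n<n; n%n≡0; [m+n]%n≡m%n; %-distribˡ-+; m%n%n≡m%n)
open import Data.Nat.Properties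
open import Data.Nat.Tactic.RingSolver using (solve-∀)
open import Data.Product using (Σ-syntax; _×_; _,_; proj₁; proj₂)
open import Data.Sum using (_⊎_; inj₁; inj₂; swap)
open import Function.Base using (_∘_)
open import Function.Bundles using (_⇔_; mk⇔; Equivalence)
open import Relation.Binary.PropositionalEquality
open import Relation.Nullary using (¬_; yes; no)

m-n≡o-p⇔m+p≡o+n : ∀ m n o p → (ℤ.+ m - ℤ.+ n ≡ ℤ.+ o - ℤ.+ p) ⇔ (m + p ≡ o + n)
m-n≡o-p⇔m+p≡o+n m n o p = mk⇔ to from
  where
  open ≡-Reasoning
  cancel-sub : ∀ (a b c : ℤ) → (a - b) ℤ.+ (b ℤ.+ c) ≡ a ℤ.+ c
  cancel-sub = ℤ-Solver.solve-∀
  shift-sub : ∀ (a b c : ℤ) → (a ℤ.+ c) - (b ℤ.+ c) ≡ a - b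
  shift-sub = ℤ-Solver.solve-∀
  to : ℤ.+ m - ℤ.+ n ≡ ℤ.+ o - ℤ.+ p → m + p ≡ o + n
  to e = +-injective (begin
    ℤ.+ (m + p)                               ≡⟨ pos-+ m p ⟩
    ℤ.+ m ℤ.+ ℤ.+ p                           ≡⟨ cancel-sub (ℤ.+ m) (ℤ.+ n) (ℤ.+ p) ⟨
    (ℤ.+ m - ℤ.+ n) ℤ.+ (ℤ.+ n ℤ.+ ℤ.+ p)     ≡⟨ cong₂ ℤ._+_ e (ℤ-+-comm (ℤ.+ n) (ℤ.+ p)) ⟩
    (ℤ.+ o - ℤ.+ p) ℤ.+ (ℤ.+ p ℤ.+ ℤ.+ n)     ≡⟨ cancel-sub (ℤ.+ o) (ℤ.+ p) (ℤ.+ n) ⟩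
    ℤ.+ o ℤ.+ ℤ.+ n                           ≡⟨ pos-+ o n ⟨
    ℤ.+ (o + n)                               ∎)
  from : m + p ≡ o + n → ℤ.+ m - ℤ.+ n ≡ ℤ.+ o - ℤ.+ p
  from e = begin
    ℤ.+ m - ℤ.+ n                             ≡⟨ shift-sub (ℤ.+ m) (ℤ.+ n) (ℤ.+ p) ⟨
    (ℤ.+ m ℤ.+ ℤ.+ p) - (ℤ.+ n ℤ.+ ℤ.+ p)     ≡⟨ cong₂ _-_ m+p≡o+n (ℤ-+-comm (ℤ.+ n) (ℤ.+ p)) ⟩
    (ℤ.+ o ℤ.+ ℤ.+ n) - (ℤ.+ p ℤ.+ ℤ.+ n)     ≡⟨ shift-sub (ℤ.+ o) (ℤ.+ p) (ℤ.+ n) ⟩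
    ℤ.+ o - ℤ.+ p                             ∎
    where
    m+p≡o+n : ℤ.+ m ℤ.+ ℤ.+ p ≡ ℤ.+ o ℤ.+ ℤ.+ n
    m+p≡o+n = trans (sym (pos-+ m p)) (trans (cong ℤ.+_ e) (pos-+ o n))

+-cancel-interleavedˡ : ∀ a b p q r s → a + p + (b + q) ≡ a + r + (b + s) → p + q ≡ r + s
+-cancel-interleavedˡ a b p q r s e = +-cancelˡ-≡ (a + b) (p + q) (r + s)
  (trans (sym (interchange +-commutativeSemigroup a p b q)) (trans e (interchange +-commutativeSemigroup a r b s)))

+-cancel-interleavedʳ : ∀ a b p q r s → p + a + (q + b) ≡ r + a + (s + b) → p + q ≡ r + s
+-cancel-interleavedʳ a b p q r s e = +-cancelʳ-≡ (a + b) (p + q) (r + s)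
  (trans (sym (interchange +-commutativeSemigroup p a q b)) (trans e (interchange +-commutativeSemigroup r a s b)))

twice-difference : ∀ a b c d e → a + d ≡ c + b → a + c ≡ e + (b + d) → 2 * a ≡ e + 2 * b
twice-difference a b c d e cross sums = +-cancelʳ-≡ (c + d) (2 * a) (e + 2 * b) (begin
  2 * a + (c + d)             ≡⟨ regroupˡ a c d ⟩
  (a + d) + (a + c)           ≡⟨ cong₂ _+_ cross sums ⟩
  (c + b) + (e + (b + d))     ≡⟨ regroupʳ b c d e ⟩
  e + 2 * b + (c + d)         ∎)
  where
  open ≡-Reasoning
  regroupˡ : ∀ a c d → 2 * a + (c + d) ≡ (a + d) + (a + c)
  regroupˡ = solve-∀
  regroupʳ : ∀ b c d e → (c + b) + (e + (b + d)) ≡ e + 2 * b + (c + d)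
  regroupʳ = solve-∀

[m%n+k]%n≡[m+k]%n : ∀ m k n .{{_ : NonZero n}} → (m % n + k) % n ≡ (m + k) % n
[m%n+k]%n≡[m+k]%n m k n = begin
  (m % n + k) % n           ≡⟨ %-distribˡ-+ (m % n) k n ⟩
  (m % n % n + k % n) % n   ≡⟨ cong (λ t → (t + k % n) % n) (m%n%n≡m%n m n) ⟩
  (m % n + k % n) % n       ≡⟨ %-distribˡ-+ m k n ⟨
  (m + k) % n               ∎
  where open ≡-Reasoning

∣m-1+m∣≡1 : ∀ m → ∣ m - suc m ∣ ≡ 1
∣m-1+m∣≡1 m = trans (m≤n⇒∣m-n∣≡n∸m (n≤1+n m)) (m+n∸n≡m 1 m)

∣0-m∣≡1+∣1-m∣ : ∀ {m} → 1 ≤ m → ∣ 0 - m ∣ ≡ suc ∣ 1 - m ∣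
∣0-m∣≡1+∣1-m∣ (s≤s z≤n) = refl

∣1+n-m∣≡1+∣n-m∣ : ∀ {m n} → m ≤ n → ∣ suc n - m ∣ ≡ suc ∣ n - m ∣
∣1+n-m∣≡1+∣n-m∣ {m} {n} m≤n
  rewrite m≤n⇒∣n-m∣≡n∸m (m≤n⇒m≤1+n m≤n) | m≤n⇒∣n-m∣≡n∸m m≤n = +-∸-assoc 1 m≤n

Near : ℕ → ℕ → Set
Near x y = x ≤ suc y × y ≤ suc x

∣-∣-near : ∀ a b → ∣ a - b ∣ ≡ 1 → ∀ v → Near ∣ a - v ∣ ∣ b - v ∣
∣-∣-near a b ∣a-b∣≡1 v =
  ≤-trans (∣-∣-triangle a b v) (≤-reflexive (cong (_+ ∣ b - v ∣) ∣a-b∣≡1)) ,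
  ≤-trans (∣-∣-triangle b a v) (≤-reflexive (cong (_+ ∣ a - v ∣) (trans (∣-∣-comm b a) ∣a-b∣≡1)))

-- Positions δ apart on a cycle of length n are joined by arcs of lengths δ and n ∸ δ.
minArc : ℕ → ℕ → ℕ
minArc n δ = δ ⊓ (n ∸ δ)

minArc-near : ∀ n {x y} → Near x y → Near (minArc n x) (minArc n y)
minArc-near n (x≤1+y , y≤1+x) = ≤-suc x≤1+y y≤1+x , ≤-suc y≤1+x x≤1+y
  where
  ≤-suc : ∀ {x y} → x ≤ suc y → y ≤ suc x → minArc n x ≤ suc (minArc n y)
  ≤-suc {x} {y} x≤1+y y≤1+x = ⊓-mono-≤ x≤1+y (m≤n+o⇒m∸n≤o n x (begin
    n                   ≤⟨ m≤n+m∸n n y ⟩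
    y + (n ∸ y)         ≤⟨ +-monoˡ-≤ (n ∸ y) y≤1+x ⟩
    suc x + (n ∸ y)     ≡⟨ +-suc x (n ∸ y) ⟨
    x + suc (n ∸ y)     ∎))
    where open ≤-Reasoning

minArc-reflect : ∀ n {x} → x ≤ n → minArc n (n ∸ x) ≡ minArc n x
minArc-reflect n {x} x≤n = trans (cong ((n ∸ x) ⊓_) (m∸[m∸n]≡n x≤n)) (⊓-comm (n ∸ x) x)

minArc-short : ∀ n {x} → x + x ≤ n → minArc n x ≡ x
minArc-short n {x} 2x≤n = m≤n⇒m⊓n≡m (m+n≤o⇒m≤o∸n x 2x≤n)

minArc-long : ∀ n {x} → n ≤ x + x → minArc n x ≡ n ∸ x
minArc-long n {x} n≤2x = m≥n⇒m⊓n≡n (m≤n+o⇒m∸n≤o n x n≤2x)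

cyclicDist : ℕ → ℕ → ℕ → ℕ
cyclicDist n a b = minArc n ∣ a - b ∣

-- Walks and shortest-path distances

module _ {G : Graph} where

  _++ʷ_ : ∀ {x y z m n} → Walk G x y m → Walk G y z n → Walk G x z (m + n)
  here     ++ʷ w = w
  step a v ++ʷ w = step a (v ++ʷ w)

  reverseʷ : (∀ {x y} → Adj G x y → Adj G y x) → ∀ {x y m} → Walk G x y m → Walk G y x m
  reverseʷ adj-sym here = here
  reverseʷ adj-sym (step {m = m} a w) =
    subst (Walk G _ _) (+-comm m 1) (reverseʷ adj-sym w ++ʷ step (adj-sym a) here)

  walks-by-symmetry : (pos : V G → ℕ) (d : V G → V G → ℕ) →
    (∀ {x y} → Adj G x y → Adj G y x) → (∀ x y → d x y ≡ d y x) →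
    (∀ x y → pos x ≤ pos y → Walk G x y (d x y)) → ∀ x y → Walk G x y (d x y)
  walks-by-symmetry pos d adj-sym d-sym walk≤ x y with ≤-total (pos x) (pos y)
  ... | inj₁ x≤y = walk≤ x y x≤y
  ... | inj₂ y≤x = subst (Walk G x y) (d-sym y x) (reverseʷ adj-sym (walk≤ y x y≤x))

record ShortestPathDistance (G : Graph) : Set where
  field
    dist      : V G → V G → ℕ
    dist-refl : ∀ x → dist x x ≡ 0
    dist-sym  : ∀ x y → dist x y ≡ dist y x
    geodesic  : ∀ x y → Walk G x y (dist x y)
    dist-adj  : ∀ {x y} z → Adj G x y → dist x z ≤ suc (dist y z)

module ShortestPathDistanceProperties {G : Graph} (M : ShortestPathDistance G) where
  open ShortestPathDistance M

  dist≤length : ∀ {x y m} → Walk G x y m → dist x y ≤ m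
  dist≤length {y = y} here       = ≤-reflexive (dist-refl y)
  dist≤length {y = y} (step a w) = ≤-trans (dist-adj y a) (s≤s (dist≤length w))

  isDist : ∀ x y → IsDist G x y (dist x y)
  isDist x y = geodesic x y , λ _ → dist≤length

  isDist⇒≡dist : ∀ {x y d} → IsDist G x y d → d ≡ dist x y
  isDist⇒≡dist (w , minimal) = ≤-antisym (minimal _ (geodesic _ _)) (dist≤length w)

  dist-triangle : ∀ x y z → dist x z ≤ dist x y + dist y z
  dist-triangle x y z = dist≤length (geodesic x y ++ʷ geodesic y z)

  geodesic-step : ∀ x z → x ≡ z ⊎ Σ[ y ∈ V G ] dist x y ≡ 1 × suc (dist y z) ≡ dist x z
  geodesic-step x z = first-step (geodesic x z) refl
    where
    first-step : ∀ {m} → Walk G x z m → m ≡ dist x z →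
                 x ≡ z ⊎ Σ[ y ∈ V G ] dist x y ≡ 1 × suc (dist y z) ≡ dist x z
    first-step here _ = inj₁ refl
    first-step (step {y = y} a w) m≡dist = inj₂ (y , dist-xy≡1 , 1+dist-yz≡dist-xz)
      where
      1+dist-yz≡dist-xz : suc (dist y z) ≡ dist x z
      1+dist-yz≡dist-xz = ≤-antisym (≤-trans (s≤s (dist≤length w)) (≤-reflexive m≡dist)) (dist-adj z a)
      dist-xy≡1 : dist x y ≡ 1
      dist-xy≡1 = ≤-antisym (dist≤length (step a here))
        (+-cancelʳ-≤ (dist y z) 1 (dist x y) (≤-trans (≤-reflexive 1+dist-yz≡dist-xz) (dist-triangle x y z)))

  module _ {Q : List (V G)} {x y : V G} where

    distDiffConst-intro : ∀ a b → (∀ {q} → q ∈ Q → dist x q + b ≡ a + dist y q) → DistDiffConst G Q x y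
    distDiffConst-intro a b offset = ℤ.+ a - ℤ.+ b , λ q q∈Q dx dy dx-isDist dy-isDist →
      subst₂ (λ dx dy → ℤ.+ dx - ℤ.+ dy ≡ ℤ.+ a - ℤ.+ b)
        (sym (isDist⇒≡dist dx-isDist)) (sym (isDist⇒≡dist dy-isDist))
        (Equivalence.from (m-n≡o-p⇔m+p≡o+n (dist x q) (dist y q) a b) (offset q∈Q))

    distDiffConst-balanced : DistDiffConst G Q x y → ∀ {q q′} → q ∈ Q → q′ ∈ Q →
                             dist x q + dist y q′ ≡ dist x q′ + dist y q
    distDiffConst-balanced (_ , const) {q} {q′} q∈Q q′∈Q =
      Equivalence.to (m-n≡o-p⇔m+p≡o+n (dist x q) (dist y q) (dist x q′) (dist y q′))
        (trans (const q q∈Q _ _ (isDist x q) (isDist y q)) (sym (const q′ q′∈Q _ _ (isDist x q′) (isDist y q′))))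

_□ᵈ_ : ∀ {G H} → ShortestPathDistance G → ShortestPathDistance H → ShortestPathDistance (G □ H)
_□ᵈ_ {G} {H} M₁ M₂ = record
  { dist      = λ p q → dist₁ (proj₁ p) (proj₁ q) + dist₂ (proj₂ p) (proj₂ q)
  ; dist-refl = λ p → cong₂ _+_ (dist-refl₁ (proj₁ p)) (dist-refl₂ (proj₂ p))
  ; dist-sym  = λ p q → cong₂ _+_ (dist-sym₁ (proj₁ p) (proj₁ q)) (dist-sym₂ (proj₂ p) (proj₂ q))
  ; geodesic  = λ p q → liftˡ (geodesic₁ (proj₁ p) (proj₁ q)) ++ʷ liftʳ (geodesic₂ (proj₂ p) (proj₂ q))
  ; dist-adj  = dist-adj-□
  }
  where
  open ShortestPathDistance M₁ renaming
    (dist to dist₁; dist-refl to dist-refl₁; dist-sym to dist-sym₁; geodesic to geodesic₁; dist-adj to dist-adj₁)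
  open ShortestPathDistance M₂ renaming
    (dist to dist₂; dist-refl to dist-refl₂; dist-sym to dist-sym₂; geodesic to geodesic₂; dist-adj to dist-adj₂)
  liftˡ : ∀ {g g′ h m} → Walk G g g′ m → Walk (G □ H) (g , h) (g′ , h) m
  liftˡ here       = here
  liftˡ (step a w) = step (inj₁ (refl , a)) (liftˡ w)
  liftʳ : ∀ {g h h′ m} → Walk H h h′ m → Walk (G □ H) (g , h) (g , h′) m
  liftʳ here       = here
  liftʳ (step a w) = step (inj₂ (refl , a)) (liftʳ w)
  dist-adj-□ : ∀ {p q} r → Adj (G □ H) p q →
    dist₁ (proj₁ p) (proj₁ r) + dist₂ (proj₂ p) (proj₂ r)
      ≤ suc (dist₁ (proj₁ q) (proj₁ r) + dist₂ (proj₂ q) (proj₂ r))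
  dist-adj-□ {g , h} (g″ , h″) (inj₁ (refl , a)) = +-monoˡ-≤ (dist₂ h h″) (dist-adj₁ g″ a)
  dist-adj-□ {g , h} {_ , h′} (g″ , h″) (inj₂ (refl , a)) =
    ≤-trans (+-monoʳ-≤ (dist₁ g g″) (dist-adj₂ h″ a)) (≤-reflexive (+-suc (dist₁ g g″) (dist₂ h′ h″)))

-- Paths and cycles

module _ {k : ℕ} where

  pathAdj⇒∣-∣≡1 : ∀ {a b : Fin k} → Adj (Path k) a b → ∣ toℕ a - toℕ b ∣ ≡ 1
  pathAdj⇒∣-∣≡1 {a} (inj₁ b≡1+a) rewrite b≡1+a = ∣m-1+m∣≡1 (toℕ a)
  pathAdj⇒∣-∣≡1 {b = b} (inj₂ a≡1+b) rewrite a≡1+b =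
    trans (∣-∣-comm (suc (toℕ b)) (toℕ b)) (∣m-1+m∣≡1 (toℕ b))

  ascend : ∀ d (a b : Fin k) → toℕ b ≡ toℕ a + d → Walk (Path k) a b d
  ascend zero a b b≡a+0 =
    subst (λ b → Walk (Path k) a b 0) (toℕ-injective (sym (trans b≡a+0 (+-identityʳ (toℕ a))))) here
  ascend (suc d) a b b≡a+1+d = step (inj₁ (toℕ-fromℕ< 1+a<k)) (ascend d (fromℕ< 1+a<k) b b≡1+a+d)
    where
    1+a<k : suc (toℕ a) < k
    1+a<k = ≤-<-trans (≤-trans (m≤m+n (suc (toℕ a)) d)
                               (≤-reflexive (trans (sym (+-suc (toℕ a) d)) (sym b≡a+1+d)))) (toℕ<n b)
    b≡1+a+d : toℕ b ≡ toℕ (fromℕ< 1+a<k) + d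
    b≡1+a+d = trans b≡a+1+d (trans (+-suc (toℕ a) d) (cong (_+ d) (sym (toℕ-fromℕ< 1+a<k))))

pathDistance : ∀ k → ShortestPathDistance (Path k)
pathDistance k = record
  { dist      = λ a b → ∣ toℕ a - toℕ b ∣
  ; dist-refl = λ a → ∣n-n∣≡0 (toℕ a)
  ; dist-sym  = λ a b → ∣-∣-comm (toℕ a) (toℕ b)
  ; geodesic  = walks-by-symmetry toℕ _ swap (λ a b → ∣-∣-comm (toℕ a) (toℕ b)) ascending
  ; dist-adj  = λ {a} {b} c a~b → proj₁ (∣-∣-near (toℕ a) (toℕ b) (pathAdj⇒∣-∣≡1 a~b) (toℕ c))
  }
  where
  ascending : ∀ (a b : Fin k) → toℕ a ≤ toℕ b → Walk (Path k) a b ∣ toℕ a - toℕ b ∣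
  ascending a b a≤b = subst (Walk (Path k) a b) (sym (m≤n⇒∣m-n∣≡n∸m a≤b))
    (ascend (toℕ b ∸ toℕ a) a b (sym (m+[n∸m]≡n a≤b)))

module _ (n : ℕ) where

  walk-around : ∀ d (i j : Fin (suc n)) → toℕ j ≡ (toℕ i + d) % suc n → Walk (Cycle (suc n)) i j d
  walk-around zero i j j≡i+0 = subst (λ j → Walk (Cycle (suc n)) i j 0)
    (toℕ-injective (sym (trans j≡i+0 (trans (cong (_% suc n) (+-identityʳ (toℕ i))) (m<n⇒m%n≡m (toℕ<n i)))))) here
  walk-around (suc d) i j j≡i+1+d = step (inj₁ (toℕ-fromℕ< next<N)) (walk-around d (fromℕ< next<N) j (begin
    toℕ j                                  ≡⟨ j≡i+1+d ⟩
    (toℕ i + suc d) % suc n                ≡⟨ cong (_% suc n) (+-suc (toℕ i) d) ⟩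
    (suc (toℕ i) + d) % suc n              ≡⟨ [m%n+k]%n≡[m+k]%n (suc (toℕ i)) d (suc n) ⟨
    (suc (toℕ i) % suc n + d) % suc n      ≡⟨ cong (λ t → (t + d) % suc n) (toℕ-fromℕ< next<N) ⟨
    (toℕ (fromℕ< next<N) + d) % suc n      ∎))
    where
    open ≡-Reasoning
    next<N : suc (toℕ i) % suc n < suc n
    next<N = m%n<n (suc (toℕ i)) (suc n)

  walk-around-shorter : ∀ (i j : Fin (suc n)) → toℕ i ≤ toℕ j →
                        Walk (Cycle (suc n)) i j (cyclicDist (suc n) (toℕ i) (toℕ j))
  walk-around-shorter i j i≤j = subst (λ t → Walk (Cycle (suc n)) i j (minArc (suc n) t))
    (sym (m≤n⇒∣m-n∣≡n∸m i≤j)) (shorter (≤-total δ (suc n ∸ δ)))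
    where
    open ≡-Reasoning
    δ : ℕ
    δ = toℕ j ∸ toℕ i
    δ≤N : δ ≤ suc n
    δ≤N = ≤-trans (m∸n≤m (toℕ j) (toℕ i)) (<⇒≤ (toℕ<n j))
    forward : Walk (Cycle (suc n)) i j δ
    forward = walk-around δ i j (trans (sym (m<n⇒m%n≡m (toℕ<n j))) (cong (_% suc n) (sym (m+[n∸m]≡n i≤j))))
    j+[N∸δ]≡i+N : toℕ j + (suc n ∸ δ) ≡ toℕ i + suc n
    j+[N∸δ]≡i+N = begin
      toℕ j + (suc n ∸ δ)          ≡⟨ cong (_+ (suc n ∸ δ)) (m∸n+n≡m i≤j) ⟨
      δ + toℕ i + (suc n ∸ δ)      ≡⟨ cong (_+ (suc n ∸ δ)) (+-comm δ (toℕ i)) ⟩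
      toℕ i + δ + (suc n ∸ δ)      ≡⟨ +-assoc (toℕ i) δ (suc n ∸ δ) ⟩
      toℕ i + (δ + (suc n ∸ δ))    ≡⟨ cong (λ t → toℕ i + t) (m+[n∸m]≡n δ≤N) ⟩
      toℕ i + suc n                ∎
    backward : Walk (Cycle (suc n)) i j (suc n ∸ δ)
    backward = reverseʷ swap (walk-around (suc n ∸ δ) j i (begin
      toℕ i                          ≡⟨ m<n⇒m%n≡m (toℕ<n i) ⟨
      toℕ i % suc n                  ≡⟨ [m+n]%n≡m%n (toℕ i) (suc n) ⟨
      (toℕ i + suc n) % suc n        ≡⟨ cong (_% suc n) j+[N∸δ]≡i+N ⟨
      (toℕ j + (suc n ∸ δ)) % suc n  ∎))
    shorter : δ ≤ suc n ∸ δ ⊎ suc n ∸ δ ≤ δ → Walk (Cycle (suc n)) i j (minArc (suc n) δ)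
    shorter (inj₁ forward≤) = subst (Walk (Cycle (suc n)) i j) (sym (m≤n⇒m⊓n≡m forward≤)) forward
    shorter (inj₂ backward≤) = subst (Walk (Cycle (suc n)) i j) (sym (m≥n⇒m⊓n≡n backward≤)) backward

  cyclicDist-next : ∀ p v → p < suc n → v < suc n →
                    Near (cyclicDist (suc n) p v) (cyclicDist (suc n) (suc p % suc n) v)
  cyclicDist-next p v p<N v<N with m≤n⇒m<n∨m≡n p<N
  ... | inj₁ 1+p<N rewrite m<n⇒m%n≡m 1+p<N = minArc-near (suc n) (∣-∣-near p (suc p) (∣m-1+m∣≡1 p) v)
  ... | inj₂ refl = subst₂ Near (sym wrap-around) (cong (λ s → cyclicDist (suc n) s v) (sym (n%n≡0 (suc n))))
    (minArc-near (suc n) (≤-refl , m≤n⇒m≤1+n (n≤1+n v)))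
    where
    open ≡-Reasoning
    v≤n : v ≤ n
    v≤n = ≤-pred v<N
    wrap-around : cyclicDist (suc n) n v ≡ minArc (suc n) (suc v)
    wrap-around = begin
      minArc (suc n) ∣ n - v ∣               ≡⟨ cong (minArc (suc n)) (m≤n⇒∣n-m∣≡n∸m v≤n) ⟩
      minArc (suc n) (n ∸ v)                 ≡⟨ minArc-reflect (suc n) (m≤n⇒m≤1+n (m∸n≤m n v)) ⟨
      minArc (suc n) (suc n ∸ (n ∸ v))       ≡⟨ cong (minArc (suc n)) (+-∸-assoc 1 (m∸n≤m n v)) ⟩
      minArc (suc n) (suc (n ∸ (n ∸ v)))     ≡⟨ cong (λ t → minArc (suc n) (suc t)) (m∸[m∸n]≡n v≤n) ⟩
      minArc (suc n) (suc v)                 ∎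

  cycleDistance : ShortestPathDistance (Cycle (suc n))
  cycleDistance = record
    { dist      = λ i j → cyclicDist (suc n) (toℕ i) (toℕ j)
    ; dist-refl = λ i → cong (minArc (suc n)) (∣n-n∣≡0 (toℕ i))
    ; dist-sym  = λ i j → cong (minArc (suc n)) (∣-∣-comm (toℕ i) (toℕ j))
    ; geodesic  = walks-by-symmetry toℕ _ swap (λ i j → cong (minArc (suc n)) (∣-∣-comm (toℕ i) (toℕ j)))
                                    walk-around-shorter
    ; dist-adj  = dist-adj-cycle
    }
    where
    dist-adj-cycle : ∀ {i j} k → Adj (Cycle (suc n)) i j →
                     cyclicDist (suc n) (toℕ i) (toℕ k) ≤ suc (cyclicDist (suc n) (toℕ j) (toℕ k))
    dist-adj-cycle {i} k (inj₁ j≡1+i) rewrite j≡1+i =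
      proj₁ (cyclicDist-next (toℕ i) (toℕ k) (toℕ<n i) (toℕ<n k))
    dist-adj-cycle {j = j} k (inj₂ i≡1+j) rewrite i≡1+j =
      proj₂ (cyclicDist-next (toℕ j) (toℕ k) (toℕ<n j) (toℕ<n k))

-- Three landmarks suffice

Separates : ∀ {G} → ShortestPathDistance G → V G → V G → Set
Separates {G} M g₁ g₂ = ∀ u v → dist u g₁ + dist v g₂ ≡ dist u g₂ + dist v g₁ → u ≡ v
  where open ShortestPathDistance M

module _ {G H : Graph} (M₁ : ShortestPathDistance G) (M₂ : ShortestPathDistance H) where
  open ShortestPathDistanceProperties (M₁ □ᵈ M₂) using (distDiffConst-balanced)
  open ShortestPathDistance M₁ using () renaming (dist to dᴳ)
  open ShortestPathDistance M₂ using () renaming (dist to dᴴ)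

  □-doublyResolving : ∀ {g₁ g₂ h₁ h₂} → Separates M₁ g₁ g₂ → Separates M₂ h₁ h₂ →
                      DoublyResolving (G □ H) ((g₁ , h₁) ∷ (g₂ , h₁) ∷ (g₁ , h₂) ∷ [])
  □-doublyResolving {g₁} {g₂} {h₁} {h₂} separatesᴳ separatesᴴ (i , a) (j , b) x≢y const = x≢y (cong₂ _,_
    (separatesᴳ i j (+-cancel-interleavedʳ (dᴴ a h₁) (dᴴ b h₁) (dᴳ i g₁) (dᴳ j g₂) (dᴳ i g₂) (dᴳ j g₁)
                                          (balanced q₁ q₂)))
    (separatesᴴ a b (+-cancel-interleavedˡ (dᴳ i g₁) (dᴳ j g₁) (dᴴ a h₁) (dᴴ b h₂) (dᴴ a h₂) (dᴴ b h₁)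
                                          (balanced q₁ q₃))))
    where
    balanced = distDiffConst-balanced const
    q₁ = here refl
    q₂ = there (here refl)
    q₃ = there (there (here refl))

□-landmarks-unique : ∀ {G H : Graph} {g₁ g₂ : V G} {h₁ h₂ : V H} → g₁ ≢ g₂ → h₁ ≢ h₂ →
                     Unique ((g₁ , h₁) ∷ (g₂ , h₁) ∷ (g₁ , h₂) ∷ [])
□-landmarks-unique g₁≢g₂ h₁≢h₂ =
  (g₁≢g₂ ∘ cong proj₁ ∷ h₁≢h₂ ∘ cong proj₂ ∷ []) ∷ (h₁≢h₂ ∘ cong proj₂ ∷ []) ∷ [] ∷ []

path-ends-separate : ∀ k → Separates (pathDistance (suc k)) zero (fromℕ k)
path-ends-separate k u v cross rewrite toℕ-fromℕ k =
  toℕ-injective (*-cancelˡ-≡ (toℕ u) (toℕ v) 2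
    (twice-difference (toℕ u) (toℕ v) ∣ toℕ u - k ∣ ∣ toℕ v - k ∣ 0 cross′ (trans (ends u) (sym (ends v)))))
  where
  cross′ : toℕ u + ∣ toℕ v - k ∣ ≡ ∣ toℕ u - k ∣ + toℕ v
  cross′ = subst₂ (λ a b → a + ∣ toℕ v - k ∣ ≡ ∣ toℕ u - k ∣ + b)
    (∣-∣-identityʳ (toℕ u)) (∣-∣-identityʳ (toℕ v)) cross
  ends : ∀ (w : Fin (suc k)) → toℕ w + ∣ toℕ w - k ∣ ≡ k
  ends w = trans (cong (λ t → toℕ w + t) (m≤n⇒∣m-n∣≡n∸m w≤k)) (m+[n∸m]≡n w≤k)
    where w≤k = ≤-pred (toℕ<n w)

module _ (m : ℕ) where
  private
    N : ℕ
    N = suc (m + m)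

    short : ∀ {x} → x ≤ m → x + x ≤ N
    short x≤m = m≤n⇒m≤1+n (+-mono-≤ x≤m x≤m)

  -- d(u,0) + d(u,m) is m for u ≤ m and m + 1 otherwise: this parity split is where oddness enters.
  OddCycleHalf : ℕ → Set
  OddCycleHalf u = (cyclicDist N u 0 ≡ u × cyclicDist N u 0 + cyclicDist N u m ≡ m)
                 ⊎ (cyclicDist N u 0 ≡ N ∸ u × cyclicDist N u 0 + cyclicDist N u m ≡ suc m)

  oddCycle-halves : ∀ u → u < N → OddCycleHalf u
  oddCycle-halves u u<N with u ≤? m
  ... | yes u≤m = inj₁ (A≡u , trans (cong₂ _+_ A≡u B≡m∸u) (m+[n∸m]≡n u≤m))
    where
    A≡u : cyclicDist N u 0 ≡ u
    A≡u = trans (cong (minArc N) (∣-∣-identityʳ u)) (minArc-short N (short u≤m))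
    B≡m∸u : cyclicDist N u m ≡ m ∸ u
    B≡m∸u = trans (cong (minArc N) (m≤n⇒∣m-n∣≡n∸m u≤m)) (minArc-short N (short (m∸n≤m m u)))
  ... | no u≰m = inj₂ (A≡N∸u , (begin
      cyclicDist N u 0 + cyclicDist N u m   ≡⟨ cong₂ _+_ A≡N∸u B≡u∸m ⟩
      N ∸ u + (u ∸ m)                       ≡⟨ +-∸-assoc (N ∸ u) m≤u ⟨
      N ∸ u + u ∸ m                         ≡⟨ cong (_∸ m) (m∸n+n≡m (<⇒≤ u<N)) ⟩
      N ∸ m                                 ≡⟨ +-∸-assoc 1 (m≤m+n m m) ⟩
      suc (m + m ∸ m)                       ≡⟨ cong suc (m+n∸n≡m m m) ⟩
      suc m                                 ∎))
    where
    open ≡-Reasoning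
    m<u : m < u
    m<u = ≰⇒> u≰m
    m≤u : m ≤ u
    m≤u = <⇒≤ m<u
    A≡N∸u : cyclicDist N u 0 ≡ N ∸ u
    A≡N∸u = trans (cong (minArc N) (∣-∣-identityʳ u)) (minArc-long N (+-mono-≤ m<u m≤u))
    B≡u∸m : cyclicDist N u m ≡ u ∸ m
    B≡u∸m = trans (cong (minArc N) (m≤n⇒∣n-m∣≡n∸m m≤u))
                  (minArc-short N (short (m≤n+o⇒m∸n≤o u m (≤-pred u<N))))

  oddCycle-separates : Separates (cycleDistance (m + m)) zero (fromℕ< (s≤s (m≤m+n m m)))
  oddCycle-separates u v cross rewrite toℕ-fromℕ< (s≤s (m≤m+n m m)) =
    toℕ-injective (separate (oddCycle-halves x (toℕ<n u)) (oddCycle-halves y (toℕ<n v)))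
    where
    x y : ℕ
    x = toℕ u
    y = toℕ v
    A B : ℕ → ℕ
    A w = cyclicDist N w 0
    B w = cyclicDist N w m
    flip : A y + B x ≡ B y + A x
    flip = trans (+-comm (A y) (B x)) (trans (sym cross) (+-comm (A x) (B y)))
    same-half : A x + B x ≡ A y + B y → A x ≡ A y
    same-half sums = *-cancelˡ-≡ (A x) (A y) 2 (twice-difference (A x) (A y) (B x) (B y) 0 cross sums)
    separate : OddCycleHalf x → OddCycleHalf y → x ≡ y
    separate (inj₁ (Ax≡x , sum-x)) (inj₁ (Ay≡y , sum-y)) =
      trans (sym Ax≡x) (trans (same-half (trans sum-x (sym sum-y))) Ay≡y)
    separate (inj₂ (Ax≡N∸x , sum-x)) (inj₂ (Ay≡N∸y , sum-y)) = ∸-cancelˡ-≡ (<⇒≤ (toℕ<n u)) (<⇒≤ (toℕ<n v))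
      (trans (sym Ax≡N∸x) (trans (same-half (trans sum-x (sym sum-y))) Ay≡N∸y))
    separate (inj₁ (_ , sum-x)) (inj₂ (_ , sum-y)) = ⊥-elim (even≢odd (A y) (A x)
      (twice-difference (A y) (A x) (B y) (B x) 1 flip (trans sum-y (cong suc (sym sum-x)))))
    separate (inj₂ (_ , sum-x)) (inj₁ (_ , sum-y)) = ⊥-elim (even≢odd (A x) (A y)
      (twice-difference (A x) (A y) (B x) (B y) 1 cross (trans sum-x (cong suc (sym sum-y)))))

-- Two landmarks never suffice

∈-pair-swap : ∀ {A : Set} {x y z : A} → z ∈ x ∷ y ∷ [] → z ∈ y ∷ x ∷ []
∈-pair-swap (here z≡x)         = there (here z≡x)
∈-pair-swap (there (here z≡y)) = here z≡y
∈-pair-swap (there (there ()))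

module _ {G : Graph} (M : ShortestPathDistance G) {g g′ : V G} (g≢g′ : g ≢ g′) (k : ℕ) where
  private
    Vertex : Set
    Vertex = V G × Fin (suc (suc k))
  open ShortestPathDistance M using (dist-refl; dist-sym) renaming (dist to dᴳ)
  open ShortestPathDistanceProperties M using (geodesic-step)
  open ShortestPathDistance (M □ᵈ pathDistance (suc (suc k))) using (dist)
  open ShortestPathDistanceProperties (M □ᵈ pathDistance (suc (suc k))) using (distDiffConst-intro)

  height : Vertex → ℕ
  height q = toℕ (proj₂ q)

  bottom≤k : ∀ {q} → height q ≡ 0 → height q ≤ k
  bottom≤k height≡0 = subst (_≤ k) (sym height≡0) z≤n

  non-top≤k : ∀ q → height q ≢ suc k → height q ≤ k
  non-top≤k (_ , c) c≢1+k = ≤-pred (≤∧≢⇒< (≤-pred (toℕ<n c)) c≢1+k)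

  record Unresolved (P : Vertex → Set) : Set where
    field
      x y    : Vertex
      x≢y    : x ≢ y
      a b    : ℕ
      offset : ∀ {q} → P q → dist x q + b ≡ a + dist y q

  unresolved⇒¬doublyResolving : ∀ {P Q} → Unresolved P → (∀ {q} → q ∈ Q → P q) →
                                ¬ DoublyResolving (G □ Path (suc (suc k))) Q
  unresolved⇒¬doublyResolving unresolved Q⊆P resolving =
    resolving x y x≢y (distDiffConst-intro a b (λ q∈Q → offset (Q⊆P q∈Q)))
    where open Unresolved unresolved

  step-away : ∀ {h h′ q} → ∣ toℕ h - height q ∣ ≡ suc ∣ toℕ h′ - height q ∣ →
              dist (g , h) q + 0 ≡ 1 + dist (g , h′) q
  step-away {h} {h′} {i , c} further = trans (+-identityʳ _)
    (trans (cong (λ t → dᴳ g i + t) further) (+-suc (dᴳ g i) ∣ toℕ h′ - toℕ c ∣))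

  unresolved-above : Unresolved (λ q → 1 ≤ height q)
  unresolved-above = record
    { x = g , zero ; y = g , suc zero ; x≢y = λ () ; a = 1 ; b = 0
    ; offset = λ {q} 1≤height → step-away {zero} {suc zero} {q} (∣0-m∣≡1+∣1-m∣ 1≤height)
    }

  unresolved-below : Unresolved (λ q → height q ≤ k)
  unresolved-below = record
    { x = g , fromℕ (suc k) ; y = g , inject₁ (fromℕ k) ; x≢y = fromℕ≢inject₁ ∘ cong proj₂ ; a = 1 ; b = 0
    ; offset = λ {q} height≤k → step-away {fromℕ (suc k)} {inject₁ (fromℕ k)} {q} (top-further height≤k)
    }
    where
    top-further : ∀ {c} → c ≤ k → ∣ toℕ (fromℕ (suc k)) - c ∣ ≡ suc ∣ toℕ (inject₁ (fromℕ k)) - c ∣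
    top-further c≤k rewrite toℕ-fromℕ (suc k) | toℕ-inject₁ (fromℕ k) | toℕ-fromℕ k = ∣1+n-m∣≡1+∣n-m∣ c≤k

  -- If the landmarks share a column, move sideways along the bottom row; otherwise trade a step
  -- up from the bottom landmark for a step along a geodesic towards the top landmark's column.
  unresolved-ends : ∀ {q₁ q₂} → height q₁ ≡ 0 → height q₂ ≡ suc k → Unresolved (_∈ q₁ ∷ q₂ ∷ [])
  unresolved-ends {i₁ , c₁} {i₂ , c₂} c₁≡0 c₂≡1+k with geodesic-step i₁ i₂
  ... | inj₁ refl = record
    { x = g , zero ; y = g′ , zero ; x≢y = g≢g′ ∘ cong proj₁ ; a = dᴳ g i₁ ; b = dᴳ g′ i₁
    ; offset = lookup (sideways c₁ ∷ sideways c₂ ∷ [])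
    }
    where
    sideways : ∀ c → dist (g , zero) (i₁ , c) + dᴳ g′ i₁ ≡ dᴳ g i₁ + dist (g′ , zero) (i₁ , c)
    sideways c = trans (+-assoc (dᴳ g i₁) (toℕ c) (dᴳ g′ i₁))
                       (cong (λ t → dᴳ g i₁ + t) (+-comm (toℕ c) (dᴳ g′ i₁)))
  ... | inj₂ (j , dᴳ-i₁j≡1 , 1+dᴳ-ji₂≡dᴳ-i₁i₂) = record
    { x = i₁ , suc zero ; y = j , zero ; x≢y = λ () ; a = 0 ; b = 0
    ; offset = lookup (near-end ∷ far-end ∷ [])
    }
    where
    near-end : dist (i₁ , suc zero) (i₁ , c₁) + 0 ≡ 0 + dist (j , zero) (i₁ , c₁)
    near-end rewrite c₁≡0 | dist-refl i₁ | dist-sym j i₁ | dᴳ-i₁j≡1 = refl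
    far-end : dist (i₁ , suc zero) (i₂ , c₂) + 0 ≡ 0 + dist (j , zero) (i₂ , c₂)
    far-end rewrite c₂≡1+k = trans (+-identityʳ _)
      (trans (cong (_+ k) (sym 1+dᴳ-ji₂≡dᴳ-i₁i₂)) (sym (+-suc (dᴳ j i₂) k)))

  ¬doublyResolving-⊆pair : ∀ q₁ q₂ {Q} → Q ⊆ q₁ ∷ q₂ ∷ [] → ¬ DoublyResolving (G □ Path (suc (suc k))) Q
  ¬doublyResolving-⊆pair q₁ q₂ Q⊆ with height q₁ ≟ 0 | height q₂ ≟ 0
  ... | no q₁≢0 | no q₂≢0 = unresolved⇒¬doublyResolving unresolved-above
    (λ q∈Q → lookup (n≢0⇒n>0 q₁≢0 ∷ n≢0⇒n>0 q₂≢0 ∷ []) (Q⊆ q∈Q))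
  ... | yes q₁≡0 | _ with height q₂ ≟ suc k
  ...   | yes q₂≡1+k = unresolved⇒¬doublyResolving (unresolved-ends q₁≡0 q₂≡1+k) Q⊆
  ...   | no q₂≢1+k = unresolved⇒¬doublyResolving unresolved-below
    (λ q∈Q → lookup (bottom≤k {q₁} q₁≡0 ∷ non-top≤k q₂ q₂≢1+k ∷ []) (Q⊆ q∈Q))
  ¬doublyResolving-⊆pair q₁ q₂ Q⊆ | no _ | yes q₂≡0 with height q₁ ≟ suc k
  ...   | yes q₁≡1+k = unresolved⇒¬doublyResolving (unresolved-ends q₂≡0 q₁≡1+k)
    (λ q∈Q → ∈-pair-swap (Q⊆ q∈Q))
  ...   | no q₁≢1+k = unresolved⇒¬doublyResolving unresolved-below
    (λ q∈Q → lookup (non-top≤k q₁ q₁≢1+k ∷ bottom≤k {q₂} q₂≡0 ∷ []) (Q⊆ q∈Q))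

  □Path-doublyResolving⇒3≤length : ∀ Q → DoublyResolving (G □ Path (suc (suc k))) Q → 3 ≤ length Q
  □Path-doublyResolving⇒3≤length [] resolving =
    ⊥-elim (¬doublyResolving-⊆pair (g , zero) (g , zero) (λ ()) resolving)
  □Path-doublyResolving⇒3≤length (q ∷ []) resolving =
    ⊥-elim (¬doublyResolving-⊆pair q q (λ { (here q′≡q) → here q′≡q }) resolving)
  □Path-doublyResolving⇒3≤length (q₁ ∷ q₂ ∷ []) resolving =
    ⊥-elim (¬doublyResolving-⊆pair q₁ q₂ (λ q∈Q → q∈Q) resolving)
  □Path-doublyResolving⇒3≤length (_ ∷ _ ∷ _ ∷ _) _ = s≤s (s≤s (s≤s z≤n))

□Path-ψ≡3 : ∀ {G} (M : ShortestPathDistance G) {g₁ g₂} → g₁ ≢ g₂ → Separates M g₁ g₂ →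
            ∀ k → ψ≡ (G □ Path (suc (suc k))) 3
□Path-ψ≡3 {G} M {g₁} {g₂} g₁≢g₂ separates k =
  ( (g₁ , zero) ∷ (g₂ , zero) ∷ (g₁ , fromℕ (suc k)) ∷ []
  , □-landmarks-unique {G} {Path (suc (suc k))} g₁≢g₂ (λ ())
  , □-doublyResolving M (pathDistance (suc (suc k))) separates (path-ends-separate (suc k))
  , refl ) ,
  λ Q _ → □Path-doublyResolving⇒3≤length M g₁≢g₂ k Q

odd⇒≡1+m+m : ∀ n → n % 2 ≡ 1 → Σ[ m ∈ ℕ ] n ≡ suc (m + m)
odd⇒≡1+m+m n n-odd = n / 2 , (begin
  n                      ≡⟨ m≡m%n+[m/n]*n n 2 ⟩
  n % 2 + n / 2 * 2      ≡⟨ cong (_+ n / 2 * 2) n-odd ⟩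
  suc (n / 2 * 2)        ≡⟨ cong suc (*-comm (n / 2) 2) ⟩
  suc (2 * (n / 2))      ≡⟨ cong (λ t → suc (n / 2 + t)) (+-identityʳ (n / 2)) ⟩
  suc (n / 2 + n / 2)    ∎)
  where open ≡-Reasoning

theorem3p1 : (n k : ℕ) → .{{_ : NonZero n}} → 3 ≤ n → n % 2 ≡ 1 → 3 ≤ k →
    ψ≡ (Cycle n □ Path k) 3
theorem3p1 _ zero       _ _ ()
theorem3p1 _ (suc zero) _ _ (s≤s ())
theorem3p1 n (suc (suc k)) 3≤n n-odd _ with odd⇒≡1+m+m n n-odd
... | zero  , refl with s≤s () ← 3≤n
... | suc m , refl = □Path-ψ≡3 (cycleDistance (suc m + suc m)) (λ ()) (oddCycle-separates (suc m)) k
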